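{- Let $F$ be a multilinear DeMorgan circuit computing a Boolean function $f:\{0,1\}^n\to\{0,1\}$, and let $F^{+}$ be the monotone circuit obtained from $F$ by replacing every negated input literal $\bar x_i$ with the constant $1$. Then $F^{+}$ is also multilinear and computes $f^{\uparrow}$. In particular, $\mathrm{mLin}(f^{\uparrow})\leq\mathrm{Lin}(f)$ holds whenever $f^{\uparrow}$ is non-constant.
   Context: A DeMorgan circuit is a directed acyclic graph whose indegree-zero nodes hold literals $x_1,\dots,x_n,\bar x_1,\dots,\bar x_n$ and whose other nodes have indegree two and are labeled $\lor$ or $\land$; size = number of gates. The upward closure of $f$ is $f^{\uparrow}(x)=\bigvee_{z\leq x}f(z)$. A Boolean function depends on $x_i$ if its value differs on some two inputs differing only in position $i$; two functions are independent if they depend on disjoint sets of variables. A circuit is multilinear if the two functions computed at the inputs of every AND gate are independent. $\mathrm{Lin}(f)$ is the minimum size of a multilinear DeMorgan circuit computing $f$; for a monotone $g$, $\mathrm{mLin}(g)$ is the minimum size of a multilinear monotone $(\lor,\land)$ circuit with only (non-negated) variables as inputs computing $g$. -}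

module Defs where

open import Data.Bool using (Bool; true; false; _∧_; _∨_; not)
open import Data.Nat using (ℕ; zero; suc; _≤_)
open import Data.Fin using (Fin; zero; suc; _≟_)
open import Data.Sum using (_⊎_; inj₁; inj₂)
open import Data.Product using (Σ; _×_; _,_; ∃; ∃-syntax)
open import Data.List using (List; []; _∷_; map; _++_)
open import Data.Bool.ListAction using (any)
open import Data.Unit using (⊤)
open import Relation.Nullary using (¬_; yes; no)
open import Relation.Binary.PropositionalEquality using (_≡_; _≢_)

Input : ℕ → Set
Input n = Fin n → Bool

BoolFun : ℕ → Set
BoolFun n = Input n → Bool

flip : ∀ {n} → Input n → Fin n → Input n
flip x i j with j ≟ i
... | yes _ = not (x j)
... | no  _ = x j

DependsOn : ∀ {n} → BoolFun n → Fin n → Set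
DependsOn g i = ∃[ x ] (g x ≢ g (flip x i))

Independent : ∀ {n} → BoolFun n → BoolFun n → Set
Independent g h = ∀ i → ¬ (DependsOn g i × DependsOn h i)

cons : ∀ {n} → Bool → Input n → Input (suc n)
cons b x zero = b
cons b x (suc i) = x i

allInputs : (n : ℕ) → List (Input n)
allInputs zero = (λ ()) ∷ []
allInputs (suc n) = map (cons false) (allInputs n) ++ map (cons true) (allInputs n)

leqB : Bool → Bool → Bool
leqB false _ = true
leqB true b = b

leqᵇ : ∀ {n} → Input n → Input n → Bool
leqᵇ {zero} z x = true
leqᵇ {suc n} z x = leqB (z zero) (x zero) ∧ leqᵇ {n} (λ i → z (suc i)) (λ i → x (suc i))

upClosure : ∀ {n} → BoolFun n → BoolFun n
upClosure {n} f x = any (λ z → leqᵇ z x ∧ f z) (allInputs n)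

NonConstant : ∀ {n} → BoolFun n → Set
NonConstant g = ∃[ x ] ∃[ y ] (g x ≢ g y)

-- A circuit with s gates is a sequence of gates; each gate has two
-- in-edges pointing at input nodes (inj₁) or earlier gates (inj₂;
-- de Bruijn style: zero = most recently added gate).

data Op : Set where
  AND OR : Op

Ref : Set → ℕ → Set
Ref L k = L ⊎ Fin k

data Gates (L : Set) : ℕ → Set where
  []  : Gates L zero
  _▷_ : ∀ {k} → Gates L k → Op × Ref L k × Ref L k → Gates L (suc k)

record Circuit (L : Set) : Set where
  constructor circuit
  field
    size   : ℕ
    gates  : Gates L size
    output : Ref L size
open Circuit public

applyOp : Op → Bool → Bool → Bool
applyOp AND a b = a ∧ b
applyOp OR  a b = a ∨ b

evalRef : ∀ {L k} → Gates L k → (L → Bool) → Ref L k → Bool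
evalRef G ρ (inj₁ l) = ρ l
evalRef (G ▷ (op , a , b)) ρ (inj₂ zero) = applyOp op (evalRef G ρ a) (evalRef G ρ b)
evalRef (G ▷ g) ρ (inj₂ (suc i)) = evalRef G ρ (inj₂ i)

nodeFun : ∀ {L n k} → (L → BoolFun n) → Gates L k → Ref L k → BoolFun n
nodeFun sem G r x = evalRef G (λ l → sem l x) r

MultilinearG : ∀ {L n k} → (L → BoolFun n) → Gates L k → Set
MultilinearG sem [] = ⊤
MultilinearG sem (G ▷ (AND , a , b)) =
  MultilinearG sem G × Independent (nodeFun sem G a) (nodeFun sem G b)
MultilinearG sem (G ▷ (OR , a , b)) = MultilinearG sem G

Multilinear : ∀ {L n} → (L → BoolFun n) → Circuit L → Set
Multilinear sem C = MultilinearG sem (gates C)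

Computes : ∀ {L n} → (L → BoolFun n) → Circuit L → BoolFun n → Set
Computes sem C f = ∀ x → nodeFun sem (gates C) (output C) x ≡ f x

-- DeMorgan circuits: input nodes are literals x_i, ¬x_i
data Literal (n : ℕ) : Set where
  pos neg : Fin n → Literal n

litSem : ∀ {n} → Literal n → BoolFun n
litSem (pos i) x = x i
litSem (neg i) x = not (x i)

-- Monotone circuits with constant 1 allowed as input (the circuit F⁺)
data MonoLeaf (n : ℕ) : Set where
  var : Fin n → MonoLeaf n
  one : MonoLeaf n

monoLeafSem : ∀ {n} → MonoLeaf n → BoolFun n
monoLeafSem (var i) x = x i
monoLeafSem one x = true

-- Monotone circuits with only (non-negated) variables as inputs
varSem : ∀ {n} → Fin n → BoolFun n
varSem i x = x i

plusLeaf : ∀ {n} → Literal n → MonoLeaf n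
plusLeaf (pos i) = var i
plusLeaf (neg i) = one

mapRef : ∀ {L L' k} → (L → L') → Ref L k → Ref L' k
mapRef h (inj₁ l) = inj₁ (h l)
mapRef h (inj₂ i) = inj₂ i

mapGates : ∀ {L L' k} → (L → L') → Gates L k → Gates L' k
mapGates h [] = []
mapGates h (G ▷ (op , a , b)) = mapGates h G ▷ (op , mapRef h a , mapRef h b)

plus : ∀ {n} → Circuit (Literal n) → Circuit (MonoLeaf n)
plus (circuit s G o) = circuit s (mapGates plusLeaf G) (mapRef plusLeaf o)

-- Write g↑ x for "some z ≤ x has g z = 1". Up-closure commutes with ∨ always, and with ∧
-- whenever the two arguments are independent: witnesses z₁ for g and z₂ for h can be glued
-- into one witness that copies z₁ on the variables of g and z₂ elsewhere. It also never
-- creates a dependence on a new variable, so multilinearity survives. Since (x_i)↑ = x_i and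
-- (¬x_i)↑ = 1, induction over the circuit shows that F⁺ computes f↑. Finally the constants 1
-- in F⁺ are propagated away, which removes gates without creating any, unless f↑ itself is 1.
module Submission where

open import Defs
open import Data.Bool using (Bool; true; false; T; _∧_; _∨_; not)
open import Data.Bool.Properties using (T-∧; T-∨; ¬-not; ∨-zeroʳ; ∧-identityʳ)
  renaming (_≟_ to _≟ᵇ_)
open import Data.Bool.ListAction using (or)
open import Data.Empty using (⊥-elim)
open import Data.Fin using (Fin; zero; suc; _≟_)
open import Data.List using (List; []; _∷_; map; allFin)
open import Data.List.Membership.Propositional using (_∈_)
open import Data.List.Membership.Propositional.Properties using (∈-allFin)
open import Data.List.Properties using (map-cong)
open import Data.List.Relation.Unary.Any as Any using (Any; here; there)
open import Data.List.Relation.Unary.Any.Properties using (map⁺; ++⁺ˡ; ++⁺ʳ; any⁺; any⁻)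
open import Data.Nat using (ℕ; zero; suc; _≤_; z≤n; s≤s)
open import Data.Nat.Properties using (m≤n⇒m≤1+n)
open import Data.Product using (_×_; _,_; proj₁; proj₂; ∃-syntax)
open import Data.Product.Function.NonDependent.Propositional using (_×-⇔_)
open import Data.Sum using (_⊎_; inj₁; inj₂)
open import Data.Sum.Function.Propositional using (_⊎-⇔_)
open import Data.Unit using (tt)
open import Data.Vec.Functional using (updateAt)
open import Data.Vec.Functional.Properties using (updateAt-updates; updateAt-minimal)
open import Function using (_∘_; const)
open import Function.Bundles using (_⇔_; mk⇔; Equivalence)
open import Function.Properties.Equivalence using () renaming (trans to ⇔-trans; sym to ⇔-sym)
open import Relation.Nullary using (¬_; Dec; yes; no)
open import Relation.Nullary.Decidable using (¬?; decidable-stable)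
open import Relation.Binary.PropositionalEquality
  using (_≡_; _≢_; _≗_; refl; sym; trans; cong; cong₂; subst; subst₂)

open Equivalence using (to; from)

private
  variable
    n : ℕ

T-⇔⇒≡ : ∀ {a b} → T a ⇔ T b → a ≡ b
T-⇔⇒≡ {false} {false} _ = refl
T-⇔⇒≡ {false} {true}  e = ⊥-elim (from e tt)
T-⇔⇒≡ {true}  {false} e = ⊥-elim (to e tt)
T-⇔⇒≡ {true}  {true}  _ = refl

leqB-T : ∀ {a b} → T (leqB a b) → T a → T b
leqB-T {true} le _ = le

-- Without function extensionality, invariance under pointwise equality of inputs
-- has to be established for each node function and carried along.
Extensional : BoolFun n → Set
Extensional g = ∀ {x y} → x ≗ y → g x ≡ g y

infix 4 _≤ᵢ_

_≤ᵢ_ : Input n → Input n → Set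
z ≤ᵢ x = ∀ i → T (leqB (z i) (x i))

Up : BoolFun n → Input n → Set
Up g x = ∃[ z ] z ≤ᵢ x × T (g z)

≤ᵢ-refl : (x : Input n) → x ≤ᵢ x
≤ᵢ-refl x i with x i
... | false = tt
... | true  = tt

≤ᵢ-respˡ-≗ : {x y z : Input n} → y ≗ z → z ≤ᵢ x → y ≤ᵢ x
≤ᵢ-respˡ-≗ {x = x} y≗z z≤x i = subst (λ b → T (leqB b (x i))) (sym (y≗z i)) (z≤x i)

leqᵇ⇒≤ᵢ : (z x : Input n) → T (leqᵇ z x) → z ≤ᵢ x
leqᵇ⇒≤ᵢ z x le zero    = proj₁ (to T-∧ le)
leqᵇ⇒≤ᵢ z x le (suc i) = leqᵇ⇒≤ᵢ (z ∘ suc) (x ∘ suc) (proj₂ (to T-∧ le)) i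

≤ᵢ⇒leqᵇ : (z x : Input n) → z ≤ᵢ x → T (leqᵇ z x)
≤ᵢ⇒leqᵇ {zero}  z x _   = tt
≤ᵢ⇒leqᵇ {suc n} z x z≤x = from T-∧ (z≤x zero , ≤ᵢ⇒leqᵇ (z ∘ suc) (x ∘ suc) (z≤x ∘ suc))

allInputs-cons⁺ : {P : Input (suc n) → Set} (b : Bool) →
                  Any (P ∘ cons b) (allInputs n) → Any P (allInputs (suc n))
allInputs-cons⁺     false = ++⁺ˡ ∘ map⁺
allInputs-cons⁺ {n} true  = ++⁺ʳ (map (cons false) (allInputs n)) ∘ map⁺

allInputs-complete : ∀ n (x : Input n) → Any (_≗ x) (allInputs n)
allInputs-complete zero    x = here (λ ())
allInputs-complete (suc n) x =
  allInputs-cons⁺ (x zero) (Any.map cons-head (allInputs-complete n (x ∘ suc)))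
  where
  cons-head : ∀ {y} → y ≗ x ∘ suc → cons (x zero) y ≗ x
  cons-head _   zero    = refl
  cons-head y≗x (suc i) = y≗x i

upClosure⇔Up : {g : BoolFun n} → Extensional g → ∀ x → T (upClosure g x) ⇔ Up g x
upClosure⇔Up {n} {g} g-ext x = mk⇔ ⇒Up Up⇒
  where
  ⇒Up : T (upClosure g x) → Up g x
  ⇒Up t with Any.satisfied (any⁻ _ (allInputs n) t)
  ... | z , z-ok = z , leqᵇ⇒≤ᵢ z x (proj₁ (to T-∧ z-ok)) , proj₂ (to T-∧ z-ok)

  Up⇒ : Up g x → T (upClosure g x)
  Up⇒ (z , z≤x , gz) = any⁺ _ (Any.map ok (allInputs-complete n z))
    where
    ok : ∀ {y} → y ≗ z → T (leqᵇ y x ∧ g y)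
    ok y≗z = from T-∧ (≤ᵢ⇒leqᵇ _ x (≤ᵢ-respˡ-≗ y≗z z≤x) , subst T (sym (g-ext y≗z)) gz)

upClosure-cong : {f g : BoolFun n} → f ≗ g → upClosure f ≗ upClosure g
upClosure-cong {n} f≗g x = cong or (map-cong (λ z → cong (leqᵇ z x ∧_) (f≗g z)) (allInputs n))

Up-∨⇔ : {g h : BoolFun n} {x : Input n} → Up (λ y → g y ∨ h y) x ⇔ (Up g x ⊎ Up h x)
Up-∨⇔ {g = g} = mk⇔ split join
  where
  split : ∀ {h x} → Up (λ y → g y ∨ h y) x → Up g x ⊎ Up h x
  split (z , z≤x , t) with to T-∨ t
  ... | inj₁ gz = inj₁ (z , z≤x , gz)
  ... | inj₂ hz = inj₂ (z , z≤x , hz)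
  join : ∀ {h x} → Up g x ⊎ Up h x → Up (λ y → g y ∨ h y) x
  join (inj₁ (z , z≤x , gz)) = z , z≤x , from T-∨ (inj₁ gz)
  join (inj₂ (z , z≤x , hz)) = z , z≤x , from T-∨ (inj₂ hz)

Up-∧⇒ : {g h : BoolFun n} {x : Input n} → Up (λ y → g y ∧ h y) x → Up g x × Up h x
Up-∧⇒ (z , z≤x , t) = (z , z≤x , proj₁ (to T-∧ t)) , (z , z≤x , proj₂ (to T-∧ t))

dependsOn-resp-≗ : {f g : BoolFun n} {i : Fin n} → f ≗ g → DependsOn f i → DependsOn g i
dependsOn-resp-≗ {i = i} f≗g (x , ne) = x , λ e → ne (trans (f≗g x) (trans e (sym (f≗g (flip x i)))))

flip-cong : {x y : Input n} → x ≗ y → ∀ i → flip x i ≗ flip y i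
flip-cong x≗y i k with k ≟ i
... | yes _ = cong not (x≗y k)
... | no  _ = x≗y k

flip-minimal : (x : Input n) (i k : Fin n) → k ≢ i → flip x i k ≡ x k
flip-minimal x i k k≢i with k ≟ i
... | yes k≡i = ⊥-elim (k≢i k≡i)
... | no  _   = refl

dependsOn? : {g : BoolFun n} → Extensional g → ∀ i → Dec (DependsOn g i)
dependsOn? {n} {g} g-ext i with Any.any? (λ y → ¬? (g y ≟ᵇ g (flip y i))) (allInputs n)
... | yes witness = yes (Any.satisfied witness)
... | no  none    = no λ (x , ne) → none (Any.map (moves ne) (allInputs-complete n x))
  where
  moves : ∀ {x y} → g x ≢ g (flip x i) → y ≗ x → g y ≢ g (flip y i)
  moves ne y≗x e = ne (trans (sym (g-ext y≗x)) (trans e (g-ext (flip-cong y≗x i))))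

≡-if-agree-off : {g : BoolFun n} {w w′ : Input n} {i : Fin n} → Extensional g →
                 (∀ k → k ≢ i → w k ≡ w′ k) → (DependsOn g i → w i ≡ w′ i) → g w ≡ g w′
≡-if-agree-off {g = g} {w} {w′} {i} g-ext off on with w i ≟ᵇ w′ i
... | yes e = g-ext pointwise
  where
  pointwise : w ≗ w′
  pointwise k with k ≟ i
  ... | yes refl = e
  ... | no  k≢i  = off k k≢i
... | no ne = trans (decidable-stable (g w ≟ᵇ g (flip w i)) (λ g≢ → ne (on (w , g≢))))
                    (g-ext flipped)
  where
  flipped : flip w i ≗ w′
  flipped k with k ≟ i
  ... | yes refl = sym (¬-not (ne ∘ sym))
  ... | no  k≢i  = off k k≢i

overwrite : Input n → List (Fin n) → Input n → Input n
overwrite y []       w = w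
overwrite y (j ∷ js) w = updateAt (overwrite y js w) j (const (y j))

overwrite-≡ : ∀ (y : Input n) js w k → k ∈ js ⊎ w k ≡ y k → overwrite y js w k ≡ y k
overwrite-≡ y []       w k (inj₂ e) = e
overwrite-≡ y (j ∷ js) w k h with k ≟ j
... | yes refl = updateAt-updates k (overwrite y js w)
... | no  k≢j  = trans (updateAt-minimal k j (overwrite y js w) k≢j) (overwrite-≡ y js w k (drop h))
  where
  drop : k ∈ j ∷ js ⊎ w k ≡ y k → k ∈ js ⊎ w k ≡ y k
  drop (inj₁ (here k≡j)) = ⊥-elim (k≢j k≡j)
  drop (inj₁ (there k∈)) = inj₁ k∈
  drop (inj₂ e)          = inj₂ e

≡-overwrite : {g : BoolFun n} {w y : Input n} → Extensional g →
              (∀ j → DependsOn g j → w j ≡ y j) → ∀ js → g w ≡ g (overwrite y js w)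
≡-overwrite g-ext agree []       = refl
≡-overwrite {g = g} {w} {y} g-ext agree (j ∷ js) =
  trans (≡-overwrite g-ext agree js) (≡-if-agree-off g-ext off on)
  where
  off : ∀ k → k ≢ j → overwrite y js w k ≡ updateAt (overwrite y js w) j (const (y j)) k
  off k k≢j = sym (updateAt-minimal k j (overwrite y js w) k≢j)
  on : DependsOn g j → overwrite y js w j ≡ updateAt (overwrite y js w) j (const (y j)) j
  on d = trans (overwrite-≡ y js w j (inj₂ (agree j d))) (sym (updateAt-updates j (overwrite y js w)))

≡-if-agree-on-dependencies : {g : BoolFun n} {x y : Input n} → Extensional g →
                             (∀ j → DependsOn g j → x j ≡ y j) → g x ≡ g y
≡-if-agree-on-dependencies {n} {x = x} {y} g-ext agree =
  trans (≡-overwrite g-ext agree (allFin n))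
        (g-ext λ k → overwrite-≡ y (allFin n) x k (inj₁ (∈-allFin k)))

Independent-anti : {g g′ h h′ : BoolFun n} →
                   (∀ {i} → ¬ DependsOn g i → ¬ DependsOn g′ i) →
                   (∀ {i} → ¬ DependsOn h i → ¬ DependsOn h′ i) →
                   Independent g h → Independent g′ h′
Independent-anti g′⊆g h′⊆h ind i (dg′ , dh′) = g′⊆g (λ dg → h′⊆h (λ dh → ind i (dg , dh)) dh′) dg′

Up-∧⇐ : {g h : BoolFun n} {x : Input n} → Extensional g → Extensional h → Independent g h →
        Up g x × Up h x → Up (λ y → g y ∧ h y) x
Up-∧⇐ {n} {g} {h} {x} g-ext h-ext ind ((z₁ , z₁≤x , gz₁) , (z₂ , z₂≤x , hz₂)) =
  z , (λ j → select-≤ (dependsOn? g-ext j)) , from T-∧ (subst T g≡ gz₁ , subst T h≡ hz₂)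
  where
  select : ∀ {j} → Dec (DependsOn g j) → Bool
  select {j} (yes _) = z₁ j
  select {j} (no  _) = z₂ j

  z : Input n
  z j = select (dependsOn? g-ext j)

  select-≤ : ∀ {j} (d : Dec (DependsOn g j)) → T (leqB (select d) (x j))
  select-≤ (yes _) = z₁≤x _
  select-≤ (no  _) = z₂≤x _

  select-g : ∀ {j} (d : Dec (DependsOn g j)) → DependsOn g j → z₁ j ≡ select d
  select-g (yes _)  _  = refl
  select-g (no  ¬d) dg = ⊥-elim (¬d dg)

  select-h : ∀ {j} (d : Dec (DependsOn g j)) → DependsOn h j → z₂ j ≡ select d
  select-h (yes dg) dh = ⊥-elim (ind _ (dg , dh))
  select-h (no  _)  _  = refl

  g≡ : g z₁ ≡ g z
  g≡ = ≡-if-agree-on-dependencies g-ext (λ j → select-g (dependsOn? g-ext j))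
  h≡ : h z₂ ≡ h z
  h≡ = ≡-if-agree-on-dependencies h-ext (λ j → select-h (dependsOn? g-ext j))

Up-resp-irrelevant : {g : BoolFun n} {x y : Input n} {i : Fin n} → Extensional g → ¬ DependsOn g i →
                     (∀ k → k ≢ i → x k ≡ y k) → Up g x → Up g y
Up-resp-irrelevant {x = x} {y} {i} g-ext ¬dg off (z , z≤x , gz) =
  z′ , z′≤y , subst T (≡-if-agree-off g-ext z≡z′-off (⊥-elim ∘ ¬dg)) gz
  where
  z′ : Input _
  z′ = updateAt z i (const false)
  z≡z′-off : ∀ k → k ≢ i → z k ≡ z′ k
  z≡z′-off k k≢i = sym (updateAt-minimal k i z k≢i)
  z′≤y : z′ ≤ᵢ y
  z′≤y k with k ≟ i
  ... | yes refl = subst (λ b → T (leqB b (y k))) (sym (updateAt-updates k z)) tt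
  ... | no  k≢i  = subst₂ (λ a b → T (leqB a b)) (z≡z′-off k k≢i) (off k k≢i) (z≤x k)

¬DependsOn-up : {g g↑ : BoolFun n} {i : Fin n} → Extensional g → (∀ x → T (g↑ x) ⇔ Up g x) →
                ¬ DependsOn g i → ¬ DependsOn g↑ i
¬DependsOn-up {g = g} {i = i} g-ext g↑⇔Up ¬dg (x , ne) =
  ne (T-⇔⇒≡ (⇔-trans (g↑⇔Up x) (⇔-trans moved (⇔-sym (g↑⇔Up (flip x i))))))
  where
  moved : Up g x ⇔ Up g (flip x i)
  moved = mk⇔ (Up-resp-irrelevant g-ext ¬dg (λ k k≢i → sym (flip-minimal x i k k≢i)))
              (Up-resp-irrelevant g-ext ¬dg (flip-minimal x i))

nodeFun-ext : ∀ {L k} {sem : L → BoolFun n} → (∀ l → Extensional (sem l)) →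
              (G : Gates L k) (r : Ref L k) → Extensional (nodeFun sem G r)
nodeFun-ext {sem = sem} sem-ext G r {x} {y} x≗y = go G r
  where
  go : ∀ {k} (G : Gates _ k) r → evalRef G (λ l → sem l x) r ≡ evalRef G (λ l → sem l y) r
  go G                  (inj₁ l)       = sem-ext l x≗y
  go (G ▷ (op , a , b)) (inj₂ zero)    = cong₂ (applyOp op) (go G a) (go G b)
  go (G ▷ _)            (inj₂ (suc i)) = go G (inj₂ i)

MultilinearG-prefix : ∀ {L k} {sem : L → BoolFun n} {G : Gates L k} op {a b} →
                      MultilinearG sem (G ▷ (op , a , b)) → MultilinearG sem G
MultilinearG-prefix AND = proj₁
MultilinearG-prefix OR  = λ ml → ml

module UpThroughCircuit {L L′ : Set} (sem : L → BoolFun n) (sem⁺ : L′ → BoolFun n)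
  (relabel : L → L′) (sem-ext : ∀ l → Extensional (sem l))
  (leaf-up : ∀ l x → T (sem⁺ (relabel l) x) ⇔ Up (sem l) x)
  where

  nodeFun⁺ : ∀ {k} → Gates L k → Ref L k → BoolFun n
  nodeFun⁺ G r = nodeFun sem⁺ (mapGates relabel G) (mapRef relabel r)

  nodeFun⁺⇔Up : ∀ {k} (G : Gates L k) → MultilinearG sem G →
                ∀ r x → T (nodeFun⁺ G r x) ⇔ Up (nodeFun sem G r) x
  nodeFun⁺⇔Up G ml (inj₁ l) x = leaf-up l x
  nodeFun⁺⇔Up (G ▷ (op , _ , _)) ml (inj₂ (suc i)) x =
    nodeFun⁺⇔Up G (MultilinearG-prefix op ml) (inj₂ i) x
  nodeFun⁺⇔Up (G ▷ (OR , a , b)) ml (inj₂ zero) x =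
    ⇔-trans T-∨ (⇔-trans (nodeFun⁺⇔Up G ml a x ⊎-⇔ nodeFun⁺⇔Up G ml b x) (⇔-sym Up-∨⇔))
  nodeFun⁺⇔Up (G ▷ (AND , a , b)) (ml , ind) (inj₂ zero) x =
    ⇔-trans T-∧ (⇔-trans (nodeFun⁺⇔Up G ml a x ×-⇔ nodeFun⁺⇔Up G ml b x)
                         (mk⇔ (Up-∧⇐ (nodeFun-ext sem-ext G a) (nodeFun-ext sem-ext G b) ind) Up-∧⇒))

  multilinear-up : ∀ {k} (G : Gates L k) → MultilinearG sem G → MultilinearG sem⁺ (mapGates relabel G)
  multilinear-up []                 _          = tt
  multilinear-up (G ▷ (OR , _ , _)) ml         = multilinear-up G ml
  multilinear-up (G ▷ (AND , a , b)) (ml , ind) =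
    multilinear-up G ml , Independent-anti (fewer a) (fewer b) ind
    where
    fewer : ∀ r {i} → ¬ DependsOn (nodeFun sem G r) i → ¬ DependsOn (nodeFun⁺ G r) i
    fewer r = ¬DependsOn-up (nodeFun-ext sem-ext G r) (nodeFun⁺⇔Up G ml r)

litSem-ext : (l : Literal n) → Extensional (litSem l)
litSem-ext (pos i) x≗y = x≗y i
litSem-ext (neg i) x≗y = cong not (x≗y i)

plusLeaf-up : (l : Literal n) (x : Input n) → T (monoLeafSem (plusLeaf l) x) ⇔ Up (litSem l) x
plusLeaf-up (pos i) x = mk⇔ (λ xi → x , ≤ᵢ-refl x , xi) (λ (z , z≤x , zi) → leqB-T (z≤x i) zi)
plusLeaf-up (neg i) x = mk⇔ (λ _ → const false , (λ _ → tt) , tt) (λ _ → tt)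

plus-multilinear-upClosure : (n : ℕ) (f : BoolFun n) (F : Circuit (Literal n)) →
    Multilinear litSem F → Computes litSem F f →
    Multilinear monoLeafSem (plus F) × Computes monoLeafSem (plus F) (upClosure f)
plus-multilinear-upClosure n f (circuit _ G o) ml computes = multilinear-up G ml , computes⁺
  where
  open UpThroughCircuit litSem monoLeafSem plusLeaf litSem-ext plusLeaf-up

  computes⁺ : ∀ x → nodeFun⁺ G o x ≡ upClosure f x
  computes⁺ x = trans (T-⇔⇒≡ (⇔-trans (nodeFun⁺⇔Up G ml o x) (⇔-sym (upClosure⇔Up o-ext x))))
                      (upClosure-cong computes x)
    where
    o-ext : Extensional (nodeFun litSem G o)
    o-ext = nodeFun-ext litSem-ext G o

-- Eliminating the constant 1

data ConstOrNode {s} (H : Gates (Fin n) s) (g : BoolFun n) : Set where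
  constant : (∀ x → g x ≡ true) → ConstOrNode H g
  node     : (r : Ref (Fin n) s) → nodeFun varSem H r ≗ g → ConstOrNode H g

weaken : ∀ {s} {H : Gates (Fin n) s} {g} gate → ConstOrNode H g → ConstOrNode (H ▷ gate) g
weaken _ (constant c)        = constant c
weaken _ (node (inj₁ i) r≗g) = node (inj₁ i) r≗g
weaken _ (node (inj₂ j) r≗g) = node (inj₂ (suc j)) r≗g

record ConstantFree {k} (H : Gates (MonoLeaf n) k) : Set where
  field
    {s}          : ℕ
    gates′       : Gates (Fin n) s
    s≤k          : s ≤ k
    multilinear′ : MultilinearG varSem gates′
    realize      : ∀ i → ConstOrNode gates′ (nodeFun monoLeafSem H (inj₂ i))

  resolve : ∀ r → ConstOrNode gates′ (nodeFun monoLeafSem H r)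
  resolve (inj₁ (var i)) = node (inj₁ i) (λ _ → refl)
  resolve (inj₁ one)     = constant (λ _ → refl)
  resolve (inj₂ i)       = realize i

module _ {k} {H : Gates (MonoLeaf n) k} (cf : ConstantFree H) (op : Op) (a b : Ref (MonoLeaf n) k) where
  open ConstantFree cf

  private
    ga gb : BoolFun n
    ga = nodeFun monoLeafSem H a
    gb = nodeFun monoLeafSem H b

  reuse : ConstOrNode gates′ (λ x → applyOp op (ga x) (gb x)) → ConstantFree (H ▷ (op , a , b))
  reuse c = record
    { gates′ = gates′ ; s≤k = m≤n⇒m≤1+n s≤k ; multilinear′ = multilinear′ ; realize = realize′ }
    where
    realize′ : ∀ i → ConstOrNode gates′ (nodeFun monoLeafSem (H ▷ (op , a , b)) (inj₂ i))
    realize′ zero    = c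
    realize′ (suc i) = realize i

  addGate : ∀ a′ b′ → nodeFun varSem gates′ a′ ≗ ga → nodeFun varSem gates′ b′ ≗ gb →
            MultilinearG monoLeafSem (H ▷ (op , a , b)) → ConstantFree (H ▷ (op , a , b))
  addGate a′ b′ a≗ b≗ ml = record
    { gates′ = gates′ ▷ (op , a′ , b′) ; s≤k = s≤s s≤k
    ; multilinear′ = multilinear-new op ml ; realize = realize′ }
    where
    multilinear-new : ∀ op → MultilinearG monoLeafSem (H ▷ (op , a , b)) →
                      MultilinearG varSem (gates′ ▷ (op , a′ , b′))
    multilinear-new AND (_ , ind) =
      multilinear′ , Independent-anti (λ ¬d d → ¬d (dependsOn-resp-≗ a≗ d))
                                      (λ ¬d d → ¬d (dependsOn-resp-≗ b≗ d)) ind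
    multilinear-new OR  _         = multilinear′
    realize′ : ∀ i → ConstOrNode (gates′ ▷ (op , a′ , b′))
                                 (nodeFun monoLeafSem (H ▷ (op , a , b)) (inj₂ i))
    realize′ zero    = node (inj₂ zero) (λ x → cong₂ (applyOp op) (a≗ x) (b≗ x))
    realize′ (suc i) = weaken _ (realize i)

extend : ∀ {k} {H : Gates (MonoLeaf n) k} op a b → MultilinearG monoLeafSem (H ▷ (op , a , b)) →
         ConstantFree H → ConstantFree (H ▷ (op , a , b))
extend op a b ml cf with ConstantFree.resolve cf a | ConstantFree.resolve cf b
extend OR  a b ml cf | constant p | _          = reuse cf OR a b (constant λ x → cong (_∨ _) (p x))
extend OR  a b ml cf | node _ _   | constant q =
  reuse cf OR a b (constant λ x → trans (cong (_ ∨_) (q x)) (∨-zeroʳ _))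
extend AND a b ml cf | constant p | constant q = reuse cf AND a b (constant λ x → cong₂ _∧_ (p x) (q x))
extend AND a b ml cf | constant p | node b′ q  =
  reuse cf AND a b (node b′ λ x → trans (q x) (cong (_∧ _) (sym (p x))))
extend AND a b ml cf | node a′ p  | constant q =
  reuse cf AND a b (node a′ λ x → trans (p x) (sym (trans (cong (_ ∧_) (q x)) (∧-identityʳ _))))
extend op  a b ml cf | node a′ p  | node b′ q  = addGate cf op a b a′ b′ p q ml

constantFree : ∀ {k} (H : Gates (MonoLeaf n) k) → MultilinearG monoLeafSem H → ConstantFree H
constantFree [] _ = record { gates′ = [] ; s≤k = z≤n ; multilinear′ = tt ; realize = λ () }
constantFree (H ▷ (op , a , b)) ml = extend op a b ml (constantFree H (MultilinearG-prefix op ml))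

eliminate-one : (C : Circuit (MonoLeaf n)) → Multilinear monoLeafSem C →
                {g : BoolFun n} → Computes monoLeafSem C g → NonConstant g →
                ∃[ G ] (Multilinear varSem G × Computes varSem G g × size G ≤ size C)
eliminate-one (circuit _ H o) ml {g} computes (x , y , gx≢gy) with ConstantFree.resolve (constantFree H ml) o
... | constant c = ⊥-elim (gx≢gy (trans (g-true x) (sym (g-true y))))
  where
  g-true : ∀ z → g z ≡ true
  g-true z = trans (sym (computes z)) (c z)
... | node r r≗ = circuit _ gates′ r , multilinear′ , (λ x → trans (r≗ x) (computes x)) , s≤k
  where open ConstantFree (constantFree H ml)

lemma6 : ((n : ℕ) (f : BoolFun n) (F : Circuit (Literal n)) →
           Multilinear litSem F → Computes litSem F f →
           Multilinear monoLeafSem (plus F) × Computes monoLeafSem (plus F) (upClosure f))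
       × ((n : ℕ) (f : BoolFun n) → NonConstant (upClosure f) →
           (F : Circuit (Literal n)) → Multilinear litSem F → Computes litSem F f →
           ∃[ G ] (Multilinear (varSem {n}) G × Computes (varSem {n}) G (upClosure f)
                   × size G ≤ size F))
lemma6 = plus-multilinear-upClosure , mLin-upClosure
  where
  mLin-upClosure : (n : ℕ) (f : BoolFun n) → NonConstant (upClosure f) →
                   (F : Circuit (Literal n)) → Multilinear litSem F → Computes litSem F f →
                   ∃[ G ] (Multilinear varSem G × Computes varSem G (upClosure f) × size G ≤ size F)
  mLin-upClosure n f nonConstant F ml computes =
    let ml⁺ , computes⁺ = plus-multilinear-upClosure n f F ml computes
    in  eliminate-one (plus F) ml⁺ computes⁺ nonConstant
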